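{- Let $D$ be a directed graph with vertices $s,t$, let $k,d$ be nonnegative integers and let $k'<k$. Let $P_1,\dots,P_{k'}\in\mathcal P(s,t)$ be paths such that $|P_i \triangle P_j| \ge 3^{k-j}d$ for all $1\le i<j\le k'$, and such that there is no path $P\in\mathcal P(s,t)$ with $|P\triangle P_j|\ge 3^{k-k'-1}d$ for all $1\le j\le k'$. Then for every $P \in \mathcal P(s, t)$ there is a unique index $i\in\{1,\dots,k'\}$ such that $|P \triangle P_i| < 3^{k - k' - 1}d$.
   Context: $\mathcal P(s,t)$ denotes the set of all directed paths from $s$ to $t$ in $D$. Paths are identified with their arc sets, so $P \triangle P'$ is the symmetric difference of the arc sets of $P$ and $P'$. -}

module Defs where

open import Data.Nat using (ℕ; zero; suc; _+_)
open import Data.Fin using (Fin; _≟_)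
open import Data.List using (List; []; _∷_; filter; length; allFin)
open import Data.List.Relation.Unary.Unique.Propositional using (Unique)
open import Data.Product using (Σ; _×_; _,_)
open import Data.Bool using (Bool; true; false; _xor_)
open import Relation.Binary.PropositionalEquality using (_≡_)
open import Relation.Nullary.Decidable using (⌊_⌋)
open import Data.List.Relation.Unary.Any using (any?)

-- A finite directed graph (parallel arcs and loops allowed):
-- vertices Fin n, arcs Fin m, each arc e goes from tail e to head e.
record Digraph : Set where
  field
    n     : ℕ
    m     : ℕ
    tail  : Fin m → Fin n
    head  : Fin m → Fin n

module _ (D : Digraph) where
  open Digraph D

  Vertex : Set
  Vertex = Fin n

  Arc : Set
  Arc = Fin m

  data Walk : Vertex → Vertex → Set where
    []  : ∀ {u} → Walk u u
    cons : ∀ {u w} (e : Arc) → tail e ≡ u → Walk (head e) w → Walk u w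

  walkVertices : ∀ {u w} → Walk u w → List Vertex
  walkVertices {u} []            = u ∷ []
  walkVertices {u} (cons e _ W)  = u ∷ walkVertices W

  walkArcs : ∀ {u w} → Walk u w → List Arc
  walkArcs []           = []
  walkArcs (cons e _ W) = e ∷ walkArcs W

  IsPath : ∀ {u w} → Walk u w → Set
  IsPath W = Unique (walkVertices W)

  Path : Vertex → Vertex → Set
  Path s t = Σ (Walk s t) IsPath

  arcSet : ∀ {s t} → Path s t → List Arc
  arcSet (W , _) = walkArcs W

  memb : Arc → List Arc → Bool
  memb a as = ⌊ any? (λ b → a ≟ b) as ⌋

  symDiffSize : ∀ {s t} → Path s t → Path s t → ℕ
  symDiffSize P Q =
    length (filter (λ a → Data.Bool._≟_ (memb a (arcSet P) xor memb a (arcSet Q)) true) (allFin m))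

{-# OPTIONS --safe #-}
-- Since |P △ Q| counts the arcs on which the indicator functions of P and Q
-- differ, it satisfies the triangle inequality. If P were within radius
-- r = 3^(k-k'-1) d of both P_i and P_j with i < j, then
-- |P_i △ P_j| < 2r ≤ 3^(k-j) d, contradicting the separation hypothesis;
-- so at most one such index exists, and some index exists because otherwise
-- P itself would be a path far from all P_j.
module Submission where

open import Defs
open import Data.Nat using (ℕ; suc; _∸_; _^_; _*_; _<_; _≤_; _+_; z≤n; s≤s; _<?_)
open import Data.Nat.Properties
open import Algebra.Properties.CommutativeSemigroup +-commutativeSemigroup
  using (interchange)
open import Data.Fin using (Fin; toℕ)
open import Data.Fin.Properties using (any?; toℕ<n; toℕ-injective)
open import Data.Product using (Σ; _×_; _,_)
open import Data.List using (List; []; _∷_; filter; length; allFin)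
open import Data.Bool using (Bool; true; false; _xor_)
import Data.Bool as Bool
open import Data.Empty using (⊥; ⊥-elim)
open import Relation.Binary using (tri<; tri≈; tri>)
open import Relation.Binary.PropositionalEquality using (_≡_; refl; sym; cong; cong₂)
open import Relation.Nullary using (¬_; yes; no)

fromBool : Bool → ℕ
fromBool false = 0
fromBool true  = 1

countTrue : {A : Set} → (A → Bool) → List A → ℕ
countTrue b xs = length (filter (λ a → b a Bool.≟ true) xs)

countTrue-∷ : {A : Set} (b : A → Bool) (x : A) (xs : List A) →
  countTrue b (x ∷ xs) ≡ fromBool (b x) + countTrue b xs
countTrue-∷ b x xs with b x
... | true  = refl
... | false = refl

xor-triangle : ∀ a b c → fromBool (b xor c) ≤ fromBool (a xor b) + fromBool (a xor c)
xor-triangle false false false = z≤n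
xor-triangle false false true  = s≤s z≤n
xor-triangle false true  false = s≤s z≤n
xor-triangle false true  true  = z≤n
xor-triangle true  false false = z≤n
xor-triangle true  false true  = s≤s z≤n
xor-triangle true  true  false = s≤s z≤n
xor-triangle true  true  true  = z≤n

countTrue-xor-triangle : {A : Set} (f g h : A → Bool) (xs : List A) →
  countTrue (λ a → g a xor h a) xs ≤
  countTrue (λ a → f a xor g a) xs + countTrue (λ a → f a xor h a) xs
countTrue-xor-triangle f g h [] = z≤n
countTrue-xor-triangle {A} f g h (x ∷ xs) = begin
  countTrue gh (x ∷ xs)
    ≡⟨ countTrue-∷ gh x xs ⟩
  fromBool (gh x) + countTrue gh xs
    ≤⟨ +-mono-≤ (xor-triangle (f x) (g x) (h x)) (countTrue-xor-triangle f g h xs) ⟩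
  (fromBool (fg x) + fromBool (fh x)) + (countTrue fg xs + countTrue fh xs)
    ≡⟨ interchange (fromBool (fg x)) _ _ _ ⟩
  (fromBool (fg x) + countTrue fg xs) + (fromBool (fh x) + countTrue fh xs)
    ≡⟨ sym (cong₂ _+_ (countTrue-∷ fg x xs) (countTrue-∷ fh x xs)) ⟩
  countTrue fg (x ∷ xs) + countTrue fh (x ∷ xs) ∎
  where
  open ≤-Reasoning
  fg gh fh : A → Bool
  fg a = f a xor g a
  gh a = g a xor h a
  fh a = f a xor h a

symDiffSize-triangle : (D : Digraph) {s t : Vertex D} (P Q R : Path D s t) →
  symDiffSize D Q R ≤ symDiffSize D P Q + symDiffSize D P R
symDiffSize-triangle D {s} {t} P Q R =
  countTrue-xor-triangle (inArcSet P) (inArcSet Q) (inArcSet R) (allFin (Digraph.m D))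
  where
  inArcSet : Path D s t → Arc D → Bool
  inArcSet X a = memb D a (arcSet D X)

module _ {X : Set} (δ : X → X → ℕ) (triangle : ∀ x y z → δ y z ≤ δ x y + δ x z) where

  separated⇒¬close-to-both : ∀ {r x y z} → r + r ≤ δ y z → δ x y < r → δ x z < r → ⊥
  separated⇒¬close-to-both {r} {x} {y} {z} r+r≤δyz δxy<r δxz<r =
    <-irrefl refl (≤-<-trans r+r≤δyz (≤-<-trans (triangle x y z) (+-mono-< δxy<r δxz<r)))

  close-centre-unique : ∀ {n r} (c : Fin n → X) →
    (∀ i j → toℕ i < toℕ j → r + r ≤ δ (c i) (c j)) →
    ∀ x i j → δ x (c i) < r → δ x (c j) < r → j ≡ i
  close-centre-unique c separated x i j δxi<r δxj<r with <-cmp (toℕ i) (toℕ j)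
  ... | tri< i<j _ _ = ⊥-elim (separated⇒¬close-to-both (separated i j i<j) δxi<r δxj<r)
  ... | tri≈ _ i≡j _ = toℕ-injective (sym i≡j)
  ... | tri> _ _ j<i = ⊥-elim (separated⇒¬close-to-both (separated j i j<i) δxj<r δxi<r)

3^m*d+3^m*d≤3^n*d : ∀ {m n} d → m < n → 3 ^ m * d + 3 ^ m * d ≤ 3 ^ n * d
3^m*d+3^m*d≤3^n*d {m} {n} d m<n = begin
  3 ^ m * d + 3 ^ m * d ≡⟨ *-distribʳ-+ d (3 ^ m) (3 ^ m) ⟨
  (3 ^ m + 3 ^ m) * d   ≤⟨ *-monoˡ-≤ d (+-monoʳ-≤ (3 ^ m) (m≤m+n (3 ^ m) (3 ^ m + 0))) ⟩
  3 ^ suc m * d         ≤⟨ *-monoˡ-≤ d (^-monoʳ-≤ 3 m<n) ⟩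
  3 ^ n * d             ∎
  where open ≤-Reasoning

k∸k′∸1<k∸suc[j] : ∀ {k k′} → k′ < k → (j : Fin k′) → k ∸ k′ ∸ 1 < k ∸ suc (toℕ j)
k∸k′∸1<k∸suc[j] {k} {k′} k′<k j = begin-strict
  k ∸ k′ ∸ 1     ≡⟨ ∸-+-assoc k k′ 1 ⟩
  k ∸ (k′ + 1)   ≡⟨ cong (k ∸_) (+-comm k′ 1) ⟩
  k ∸ suc k′     <⟨ ∸-monoʳ-< (s≤s (toℕ<n j)) k′<k ⟩
  k ∸ suc (toℕ j) ∎
  where open ≤-Reasoning

lemma10 : (D : Digraph) (s t : Vertex D) (k d k′ : ℕ) → k′ < k →
    (Ps : Fin k′ → Path D s t) →
    ((i j : Fin k′) → toℕ i < toℕ j →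
      3 ^ (k ∸ suc (toℕ j)) * d ≤ symDiffSize D (Ps i) (Ps j)) →
    ¬ Σ (Path D s t) (λ P → (j : Fin k′) →
      3 ^ (k ∸ k′ ∸ 1) * d ≤ symDiffSize D P (Ps j)) →
    (P : Path D s t) →
    Σ (Fin k′) (λ i → (symDiffSize D P (Ps i) < 3 ^ (k ∸ k′ ∸ 1) * d)
      × ((j : Fin k′) → symDiffSize D P (Ps j) < 3 ^ (k ∸ k′ ∸ 1) * d → j ≡ i))
lemma10 D s t k d k′ k′<k Ps separated noFarPath P
  with any? (λ i → symDiffSize D P (Ps i) <? 3 ^ (k ∸ k′ ∸ 1) * d)
... | yes (i , closeᵢ) =
  i , closeᵢ , λ j closeⱼ →
    close-centre-unique (symDiffSize D) (symDiffSize-triangle D) Ps twice-radius-separated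
      P i j closeᵢ closeⱼ
  where
  twice-radius-separated : ∀ i j → toℕ i < toℕ j →
    3 ^ (k ∸ k′ ∸ 1) * d + 3 ^ (k ∸ k′ ∸ 1) * d ≤ symDiffSize D (Ps i) (Ps j)
  twice-radius-separated i j i<j =
    ≤-trans (3^m*d+3^m*d≤3^n*d d (k∸k′∸1<k∸suc[j] k′<k j)) (separated i j i<j)
... | no noClose = ⊥-elim (noFarPath (P , λ j → ≮⇒≥ (λ closeⱼ → noClose (j , closeⱼ))))
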